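{- Let $g,n\in\mathbb{N}$ with $g>3$ and $2\le n\le g-2$. A numerical semigroup $T\in\mathcal{H}_{g,n}$ is a leaf of $\mathcal{T}_{g,n}$ if and only if for every $h\in\operatorname{SG}(T)$, either $h>\operatorname{m}(T)$, or for every minimal generator $y$ of $T\cup\{h\}$ with $y\neq h$ and $y<\operatorname{F}(T)$ one has: $y<\frac{\operatorname{F}(T)}{2}$ if $T\cup\{h\}$ is irreducible, and $y<\max\big(\operatorname{SG}(T\cup\{h\})\setminus\{\operatorname{F}(T)\}\big)$ if $T\cup\{h\}$ is not irreducible.
   Context: $\mathbb{N}=\{0,1,2,\ldots\}$. A numerical semigroup is a submonoid $S$ of $(\mathbb{N},+)$ with $\mathbb{N}\setminus S$ finite; a minimal generator is an element of $S\setminus\{0\}$ not expressible as a sum of two elements of $S\setminus\{0\}$. $\operatorname{H}(S)=\mathbb{N}\setminus S$; $\operatorname{g}(S)=|\operatorname{H}(S)|$; $\operatorname{F}(S)=\max\operatorname{H}(S)$; $\operatorname{m}(S)=\min(S\setminus\{0\})$; $\operatorname{n}(S)=|\{s\in S\mid s<\operatorname{F}(S)\}|$. Special gaps: $\operatorname{SG}(S)=\{h\in\operatorname{H}(S)\mid 2h\in S \text{ and } h+s\in S \text{ for all } s\in S\setminus\{0\}\}$. $S$ is special if there is no $h\in\operatorname{SG}(S)\setminus\{\operatorname{F}(S)\}$ with $h>\operatorname{m}(S)$. $S$ is irreducible if it cannot be written as the intersection of two numerical semigroups properly containing $S$. For non special $S$, $\mathcal{A}(S)=(S\cup\{h\})\setminus\{\operatorname{m}(S)\}$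 with $h=\max(\operatorname{SG}(S)\setminus\{\operatorname{F}(S)\})$. $S_{g,n}=\{0\}\cup\{g,\ldots,g+n-2\}\cup\{x\in\mathbb{N}\mid x\ge g+n\}$. $\mathcal{H}_{g,n}$ is the set consisting of $S_{g,n}$ and all non special numerical semigroups $S$ with $\operatorname{g}(S)=g$, $\operatorname{n}(S)=n$. $\mathcal{T}_{g,n}$ is the oriented graph with vertex set $\mathcal{H}_{g,n}$ and edges all pairs $(S,\mathcal{A}(S))$ with $S\in\mathcal{H}_{g,n}$ non special; $S$ is a child of $T$ if $(S,T)$ is an edge, and a leaf is a vertex with no children. -}

module Defs where

open import Data.Nat using (ℕ; zero; suc; _+_; _*_; _∸_; _≤_; _<_; _≡ᵇ_; _≤ᵇ_; _<ᵇ_)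
open import Data.Bool using (Bool; true; false; _∨_; _∧_; not)
open import Data.Product using (Σ; ∃; _×_; _,_)
open import Data.Sum using (_⊎_)
open import Relation.Nullary using (¬_)
open import Relation.Binary.PropositionalEquality using (_≡_; _≢_)

NSet : Set
NSet = ℕ → Bool

_∈_ : ℕ → NSet → Set
x ∈ S = S x ≡ true

_∉_ : ℕ → NSet → Set
x ∉ S = S x ≡ false

_∪[_] : NSet → ℕ → NSet
(S ∪[ h ]) x = S x ∨ (x ≡ᵇ h)

IsNumSG : NSet → Set
IsNumSG S =
  (0 ∈ S) ×
  (∀ x y → x ∈ S → y ∈ S → (x + y) ∈ S) ×
  (∃ λ c → ∀ x → c ≤ x → x ∈ S)

countGaps : NSet → ℕ → ℕ
countGaps S zero = 0
countGaps S (suc c) with S c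
... | true  = countGaps S c
... | false = suc (countGaps S c)

countMem : NSet → ℕ → ℕ
countMem S zero = 0
countMem S (suc c) with S c
... | true  = suc (countMem S c)
... | false = countMem S c

HasGenus : NSet → ℕ → Set
HasGenus S g = ∃ λ c → (∀ x → c ≤ x → x ∈ S) × countGaps S c ≡ g

IsFrob : NSet → ℕ → Set
IsFrob S f = (f ∉ S) × (∀ x → f < x → x ∈ S)

IsMult : NSet → ℕ → Set
IsMult S m = (m ∈ S) × (m ≢ 0) × (∀ x → x ∈ S → x ≢ 0 → m ≤ x)

HasN : NSet → ℕ → Set
HasN S n = ∃ λ f → IsFrob S f × countMem S f ≡ n

IsSG : NSet → ℕ → Set
IsSG S h = (h ∉ S) × ((2 * h) ∈ S) × (∀ s → s ∈ S → s ≢ 0 → (h + s) ∈ S)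

IsMaxSGExcept : NSet → ℕ → ℕ → Set
IsMaxSGExcept S e k = IsSG S k × k ≢ e × (∀ k' → IsSG S k' → k' ≢ e → k' ≤ k)

Special : NSet → Set
Special S = ∀ f m → IsFrob S f → IsMult S m →
            ∀ h → IsSG S h → h ≢ f → h ≤ m

IsMinGen : NSet → ℕ → Set
IsMinGen S y = (y ∈ S) × (y ≢ 0) ×
  ¬ (Σ ℕ λ a → Σ ℕ λ b → (a ∈ S) × (b ∈ S) × (a ≢ 0) × (b ≢ 0) × (a + b ≡ y))

_⊂_ : NSet → NSet → Set
S ⊂ S' = (∀ x → x ∈ S → x ∈ S') × (∃ λ x → (x ∈ S') × (x ∉ S))

Irreducible : NSet → Set
Irreducible S = ¬ (Σ NSet λ S₁ → Σ NSet λ S₂ →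
  IsNumSG S₁ × IsNumSG S₂ × (S ⊂ S₁) × (S ⊂ S₂) × (∀ x → S x ≡ (S₁ x ∧ S₂ x)))

Sgn : ℕ → ℕ → NSet
Sgn g n x = (x ≡ᵇ 0) ∨ ((g ≤ᵇ x) ∧ (x <ᵇ (g + n ∸ 1))) ∨ ((g + n) ≤ᵇ x)

InH : ℕ → ℕ → NSet → Set
InH g n S = IsNumSG S ×
  ((∀ x → S x ≡ Sgn g n x) ⊎ ((¬ Special S) × HasGenus S g × HasN S n))

IsA : NSet → NSet → Set
IsA S T = Σ ℕ λ f → Σ ℕ λ h → Σ ℕ λ m →
  IsFrob S f × IsMaxSGExcept S f h × IsMult S m ×
  (∀ x → T x ≡ ((S x ∨ (x ≡ᵇ h)) ∧ not (x ≡ᵇ m)))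

IsLeaf : ℕ → ℕ → NSet → Set
IsLeaf g n T = ¬ (Σ NSet λ S → InH g n S × (¬ Special S) × IsA S T)

{-# OPTIONS --safe #-}
-- T is not a leaf exactly when T = A(S) for a non-special S. Writing h = m(S) and y for the largest
-- special gap of S other than F, such an S equals (T ∪ {h}) ∖ {y}, where h is a special gap of T below
-- m(T) and y ≠ h is a minimal generator of T ∪ {h} below F. Conversely, for such h and y the semigroup
-- (T ∪ {h}) ∖ {y} has the genus and n of T, is non-special, and maps to T under A, as soon as y is its
-- largest special gap other than F. Since that gap k of any semigroup satisfies F < 2k, and a semigroup
-- is irreducible iff F is its only special gap, this happens exactly when F ≤ 2y and every special gap
-- of T ∪ {h} other than F lies below y, i.e. exactly when the bound on y fails.

module Submission where

open import Defs
open import Data.Nat using (ℕ; _+_; _*_; _∸_; _≤_; _<_)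
open import Data.Sum using (_⊎_)
open import Data.Product using (_×_)
open import Relation.Nullary using (¬_)
open import Relation.Binary.PropositionalEquality using (_≢_)
open import Function.Bundles using (_⇔_)

open import Data.Nat using (zero; suc; _≡ᵇ_; _≤ᵇ_; _<ᵇ_; _≟_; _<?_; z≤n; s≤s)
open import Data.Nat.Properties
open import Data.Bool using (true; false; _∨_; _∧_; not; T)
open import Data.Bool.Properties
  using (T-≡; T-∨; T-∧; ∨-zeroʳ; ∨-identityʳ; ∧-zeroʳ; ∧-identityʳ; ∧-comm; ∧-abs-∨)
import Data.Bool.Properties as Bool
open import Data.Empty using (⊥; ⊥-elim)
open import Data.Product using (∃-syntax; _,_; proj₁; proj₂)
open import Data.Sum using (inj₁; inj₂; [_,_]′)
import Data.Sum as Sum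
open import Function using (_∘_; case_of_)
open import Function.Bundles using (Equivalence; mk⇔)
open import Relation.Nullary using (Dec; yes; no; contradiction; ¬?)
open import Relation.Nullary.Decidable using (_×-dec_)
open import Relation.Unary using (Decidable)
open import Relation.Binary.PropositionalEquality
  using (_≡_; refl; sym; trans; cong; cong₂; subst; subst₂; ≢-sym; module ≡-Reasoning)

private
  variable
    A B : NSet
    a b c f h k m x y : ℕ

infix 4 _≐_
_≐_ : NSet → NSet → Set
A ≐ B = ∀ x → A x ≡ B x

∈-∉-≢ : ∀ A → x ∈ A → y ∉ A → x ≢ y
∈-∉-≢ A x∈A y∉A refl = contradiction (trans (sym x∈A) y∉A) λ ()

¬∈⇒∉ : ∀ A → ¬ x ∈ A → x ∉ A
¬∈⇒∉ {x} A x∉A with A x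
... | true  = contradiction refl x∉A
... | false = refl

_∈?_ : (x : ℕ) (A : NSet) → Dec (x ∈ A)
x ∈? A = A x Bool.≟ true

≐-sym : A ≐ B → B ≐ A
≐-sym A≐B x = sym (A≐B x)

≐-trans : ∀ {C} → A ≐ B → B ≐ C → A ≐ C
≐-trans A≐B B≐C x = trans (A≐B x) (B≐C x)

∈-resp-≐ : A ≐ B → x ∈ A → x ∈ B
∈-resp-≐ {x = x} A≐B x∈A = trans (sym (A≐B x)) x∈A

∉-resp-≐ : A ≐ B → x ∉ A → x ∉ B
∉-resp-≐ {x = x} A≐B x∉A = trans (sym (A≐B x)) x∉A

≡ᵇ-refl : ∀ x → (x ≡ᵇ x) ≡ true
≡ᵇ-refl x = Equivalence.to T-≡ (≡⇒≡ᵇ x x refl)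

≢⇒≡ᵇ≡false : x ≢ y → (x ≡ᵇ y) ≡ false
≢⇒≡ᵇ≡false {x} {y} x≢y = ¬∈⇒∉ (x ≡ᵇ_) (x≢y ∘ ≡ᵇ⇒≡ x y ∘ Equivalence.from T-≡)

-- With this, IsA S T says precisely T ≐ (S ∪[ h ]) ∖[ m ].
_∖[_] : NSet → ℕ → NSet
(A ∖[ y ]) x = A x ∧ not (x ≡ᵇ y)

∪[]-≢ : ∀ A → x ≢ h → (A ∪[ h ]) x ≡ A x
∪[]-≢ A x≢h rewrite ≢⇒≡ᵇ≡false x≢h = ∨-identityʳ (A _)

∖[]-≢ : ∀ A → x ≢ y → (A ∖[ y ]) x ≡ A x
∖[]-≢ A x≢y rewrite ≢⇒≡ᵇ≡false x≢y = ∧-identityʳ (A _)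

∈-∪[]-self : ∀ A → h ∈ (A ∪[ h ])
∈-∪[]-self {h} A rewrite ≡ᵇ-refl h = ∨-zeroʳ (A h)

∉-∖[]-self : ∀ A → y ∉ (A ∖[ y ])
∉-∖[]-self {y} A rewrite ≡ᵇ-refl y = ∧-zeroʳ (A y)

∈-∪[]⁺ : ∀ A → x ∈ A → x ∈ (A ∪[ h ])
∈-∪[]⁺ {x} {h} A x∈A with x ≟ h
... | yes refl = ∈-∪[]-self A
... | no x≢h   = trans (∪[]-≢ A x≢h) x∈A

∈-∪[]⁻ : ∀ A → x ∈ (A ∪[ h ]) → x ∈ A ⊎ x ≡ h
∈-∪[]⁻ {x} {h} A x∈A∪h with x ≟ h
... | yes x≡h = inj₂ x≡h
... | no x≢h  = inj₁ (trans (sym (∪[]-≢ A x≢h)) x∈A∪h)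

∉-∪[]⁺ : ∀ A → x ∉ A → x ≢ h → x ∉ (A ∪[ h ])
∉-∪[]⁺ A x∉A x≢h = trans (∪[]-≢ A x≢h) x∉A

∉-∪[]⁻ : ∀ A → x ∉ (A ∪[ h ]) → x ∉ A
∉-∪[]⁻ A x∉A∪h = ¬∈⇒∉ A λ x∈A → ∈-∉-≢ (A ∪[ _ ]) (∈-∪[]⁺ A x∈A) x∉A∪h refl

∈-∖[]⁺ : ∀ A → x ∈ A → x ≢ y → x ∈ (A ∖[ y ])
∈-∖[]⁺ A x∈A x≢y = trans (∖[]-≢ A x≢y) x∈A

∈-∖[]⁻ : ∀ A → x ∈ (A ∖[ y ]) → x ∈ A × x ≢ y
∈-∖[]⁻ {x} {y} A x∈A∖y with x ≟ y
... | yes refl = contradiction (trans (sym x∈A∖y) (∉-∖[]-self A)) λ ()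
... | no x≢y   = trans (sym (∖[]-≢ A x≢y)) x∈A∖y , x≢y

∉-∖[]⁺ : ∀ A → x ∉ A → x ∉ (A ∖[ y ])
∉-∖[]⁺ A x∉A rewrite x∉A = refl

∉-∖[]⁻ : ∀ A → x ∉ (A ∖[ y ]) → x ≢ y → x ∉ A
∉-∖[]⁻ A x∉A∖y x≢y = trans (sym (∖[]-≢ A x≢y)) x∉A∖y

∪[]-∖[]-cancel : ∀ A → h ∉ A → (A ∪[ h ]) ∖[ h ] ≐ A
∪[]-∖[]-cancel {h} A h∉A x with x ≟ h
... | yes refl = trans (∉-∖[]-self (A ∪[ h ])) (sym h∉A)
... | no x≢h   = trans (∖[]-≢ (A ∪[ h ]) x≢h) (∪[]-≢ A x≢h)

∖[]-∪[]-cancel : ∀ A → y ∈ A → (A ∖[ y ]) ∪[ y ] ≐ A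
∖[]-∪[]-cancel {y} A y∈A x with x ≟ y
... | yes refl = trans (∈-∪[]-self (A ∖[ y ])) (sym y∈A)
... | no x≢y   = trans (∪[]-≢ (A ∖[ y ]) x≢y) (∖[]-≢ A x≢y)

∪[]-resp-≐ : A ≐ B → A ∪[ h ] ≐ B ∪[ h ]
∪[]-resp-≐ {h = h} A≐B x = cong (_∨ (x ≡ᵇ h)) (A≐B x)

∖[]-resp-≐ : A ≐ B → A ∖[ y ] ≐ B ∖[ y ]
∖[]-resp-≐ {y = y} A≐B x = cong (_∧ not (x ≡ᵇ y)) (A≐B x)

countMem-cong : ∀ c → (∀ x → x < c → A x ≡ B x) → countMem A c ≡ countMem B c
countMem-cong zero    _   = refl
countMem-cong {A} {B} (suc c) A≡B
  with A c | B c | A≡B c ≤-refl | countMem-cong c (λ x x<c → A≡B x (m<n⇒m<1+n x<c))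
... | true  | true  | _ | ih = cong suc ih
... | false | false | _ | ih = ih

countMem-insert : ∀ {p} c → p < c → A p ≡ false → B p ≡ true →
                  (∀ x → x ≢ p → A x ≡ B x) → countMem B c ≡ suc (countMem A c)
countMem-insert {A} {B} {p} (suc c) p<1+c Ap Bp A≡B with m<1+n⇒m<n∨m≡n p<1+c
... | inj₂ refl rewrite Ap | Bp = cong suc (countMem-cong c (λ x x<c → sym (A≡B x (<⇒≢ x<c))))
... | inj₁ p<c
  with A c | B c | A≡B c (≢-sym (<⇒≢ p<c)) | countMem-insert c p<c Ap Bp A≡B
...   | true  | true  | _ | ih = cong suc ih
...   | false | false | _ | ih = ih

countMem+countGaps : ∀ A c → countMem A c + countGaps A c ≡ c
countMem+countGaps A zero = refl
countMem+countGaps A (suc c) with A c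
... | true  = cong suc (countMem+countGaps A c)
... | false = trans (+-suc _ _) (cong suc (countMem+countGaps A c))

countGaps-cong-countMem : ∀ A B c → countMem A c ≡ countMem B c → countGaps A c ≡ countGaps B c
countGaps-cong-countMem A B c eq = +-cancelˡ-≡ (countMem A c) _ _ (begin
  countMem A c + countGaps A c ≡⟨ countMem+countGaps A c ⟩
  c                            ≡⟨ sym (countMem+countGaps B c) ⟩
  countMem B c + countGaps B c ≡⟨ cong (_+ countGaps B c) (sym eq) ⟩
  countMem A c + countGaps B c ∎)
  where open ≡-Reasoning

HasGenus-resp-≐ : ∀ {g} → A ≐ B → HasGenus A g → HasGenus B g
HasGenus-resp-≐ {A} {B} A≐B (c , above , gaps) =
  c , (λ x c≤x → ∈-resp-≐ A≐B (above x c≤x)) ,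
  trans (countGaps-cong-countMem B A c (countMem-cong c λ x _ → sym (A≐B x))) gaps

countMem-suc-∈ : ∀ A → c ∈ A → countMem A (suc c) ≡ suc (countMem A c)
countMem-suc-∈ A c∈A rewrite c∈A = refl

countMem-suc-∉ : ∀ A → c ∉ A → countMem A (suc c) ≡ countMem A c
countMem-suc-∉ A c∉A rewrite c∉A = refl

countMem-run-∈ : ∀ A a k → (∀ x → a ≤ x → x < a + k → x ∈ A) →
                 countMem A (a + k) ≡ countMem A a + k
countMem-run-∈ A a zero _ = trans (cong (countMem A) (+-identityʳ a)) (sym (+-identityʳ _))
countMem-run-∈ A a (suc k) run = begin
  countMem A (a + suc k)   ≡⟨ cong (countMem A) (+-suc a k) ⟩
  countMem A (suc (a + k)) ≡⟨ countMem-suc-∈ A (run (a + k) (m≤m+n a k) a+k<a+1+k) ⟩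
  suc (countMem A (a + k)) ≡⟨ cong suc (countMem-run-∈ A a k λ x a≤x x<a+k →
                                run x a≤x (<-trans x<a+k a+k<a+1+k)) ⟩
  suc (countMem A a + k)   ≡⟨ sym (+-suc _ k) ⟩
  countMem A a + suc k     ∎
  where
  open ≡-Reasoning
  a+k<a+1+k : a + k < a + suc k
  a+k<a+1+k = +-monoʳ-< a (n<1+n k)

countMem-run-∉ : ∀ A a k → (∀ x → a ≤ x → x < a + k → x ∉ A) →
                 countMem A (a + k) ≡ countMem A a
countMem-run-∉ A a zero _ = cong (countMem A) (+-identityʳ a)
countMem-run-∉ A a (suc k) run = begin
  countMem A (a + suc k)   ≡⟨ cong (countMem A) (+-suc a k) ⟩
  countMem A (suc (a + k)) ≡⟨ countMem-suc-∉ A (run (a + k) (m≤m+n a k) a+k<a+1+k) ⟩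
  countMem A (a + k)       ≡⟨ countMem-run-∉ A a k (λ x a≤x x<a+k →
                                run x a≤x (<-trans x<a+k a+k<a+1+k)) ⟩
  countMem A a             ∎
  where
  open ≡-Reasoning
  a+k<a+1+k : a + k < a + suc k
  a+k<a+1+k = +-monoʳ-< a (n<1+n k)

countMem-∪[] : ∀ A → h ∉ A → h < c → countMem (A ∪[ h ]) c ≡ suc (countMem A c)
countMem-∪[] A h∉A h<c =
  countMem-insert _ h<c h∉A (∈-∪[]-self A) (λ x x≢h → sym (∪[]-≢ A x≢h))

countMem-∖[] : ∀ A → y ∈ A → y < c → countMem A c ≡ suc (countMem (A ∖[ y ]) c)
countMem-∖[] A y∈A y<c =
  countMem-insert _ y<c (∉-∖[]-self A) y∈A (λ x x≢y → ∖[]-≢ A x≢y)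

countMem≤1 : ∀ A c → (∀ x → x < c → x ∈ A → x ≡ 0) → countMem A c ≤ 1
countMem≤1 A zero _ = z≤n
countMem≤1 A (suc c) only0 with A c in c∈A?
... | false = countMem≤1 A c (λ x x<c → only0 x (m<n⇒m<1+n x<c))
... | true with only0 c ≤-refl c∈A?
...   | refl = s≤s z≤n

∉⇒≢0 : ∀ A → 0 ∈ A → x ∉ A → x ≢ 0
∉⇒≢0 A 0∈A x∉A x≡0 = ∈-∉-≢ A 0∈A x∉A (sym x≡0)

gap≤Frob : ∀ A → IsFrob A f → x ∉ A → x ≤ f
gap≤Frob A (_ , above) x∉A = ≮⇒≥ λ f<x → ∈-∉-≢ A (above _ f<x) x∉A refl

Frob-unique : ∀ A → IsFrob A a → IsFrob A b → a ≡ b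
Frob-unique A Fa Fb = ≤-antisym (gap≤Frob A Fb (proj₁ Fa)) (gap≤Frob A Fa (proj₁ Fb))

Mult-unique : ∀ A → IsMult A a → IsMult A b → a ≡ b
Mult-unique A (a∈A , a≢0 , a-min) (b∈A , b≢0 , b-min) =
  ≤-antisym (a-min _ b∈A b≢0) (b-min _ a∈A a≢0)

countMem-belowMult : ∀ A → IsMult A m → c ≤ m → countMem A c ≤ 1
countMem-belowMult {m} {c} A (_ , _ , m-min) c≤m = countMem≤1 A c only0
  where
  only0 : ∀ x → x < c → x ∈ A → x ≡ 0
  only0 x x<c x∈A with x ≟ 0
  ... | yes x≡0 = x≡0
  ... | no x≢0  = contradiction (m-min x x∈A x≢0) (<⇒≱ (<-≤-trans x<c c≤m))

IsFrob-resp-≐ : A ≐ B → IsFrob A f → IsFrob B f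
IsFrob-resp-≐ A≐B (f∉A , above) = ∉-resp-≐ A≐B f∉A , λ x f<x → ∈-resp-≐ A≐B (above x f<x)

IsFrob-∪[] : ∀ A → IsFrob A f → h ≢ f → IsFrob (A ∪[ h ]) f
IsFrob-∪[] A (f∉A , above) h≢f = ∉-∪[]⁺ A f∉A (≢-sym h≢f) , λ x f<x → ∈-∪[]⁺ A (above x f<x)

IsFrob-∖[] : ∀ A → IsFrob A f → y < f → IsFrob (A ∖[ y ]) f
IsFrob-∖[] A (f∉A , above) y<f =
  ∉-∖[]⁺ A f∉A , λ x f<x → ∈-∖[]⁺ A (above x f<x) (≢-sym (<⇒≢ (<-trans y<f f<x)))

HasSGExcept : NSet → ℕ → Set
HasSGExcept A f = ∃[ k ] (IsSG A k × k ≢ f)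

IsPF : NSet → ℕ → Set
IsPF A x = (x ∉ A) × (∀ s → s ∈ A → s ≢ 0 → (x + s) ∈ A)

2*m≡m+m : ∀ m → 2 * m ≡ m + m
2*m≡m+m m = cong (m +_) (+-identityʳ m)

m+n≢m : ∀ m {n} → n ≢ 0 → m + n ≢ m
m+n≢m m n≢0 = ≢-sym (<⇒≢ (m<m+n m (n≢0⇒n>0 n≢0)))

2*-∈ : ∀ A → IsNumSG A → x ∈ A → (2 * x) ∈ A
2*-∈ {x} A (_ , +-closed , _) x∈A = subst (_∈ A) (sym (2*m≡m+m x)) (+-closed x x x∈A x∈A)

IsSG-resp-≐ : A ≐ B → IsSG A k → IsSG B k
IsSG-resp-≐ A≐B (k∉A , 2k∈A , k+A⊆A) =
  ∉-resp-≐ A≐B k∉A , ∈-resp-≐ A≐B 2k∈A ,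
  λ s s∈B s≢0 → ∈-resp-≐ A≐B (k+A⊆A s (∈-resp-≐ (≐-sym A≐B) s∈B) s≢0)

IsMinGen-resp-≐ : A ≐ B → IsMinGen A y → IsMinGen B y
IsMinGen-resp-≐ A≐B (y∈A , y≢0 , indecomposable) =
  ∈-resp-≐ A≐B y∈A , y≢0 ,
  λ (a , b , a∈B , b∈B , ab≢0) →
    indecomposable (a , b , ∈-resp-≐ (≐-sym A≐B) a∈B , ∈-resp-≐ (≐-sym A≐B) b∈B , ab≢0)

Frob-IsSG : ∀ A → IsNumSG A → IsFrob A f → IsSG A f
Frob-IsSG {f} A (0∈A , _) (f∉A , above) =
  f∉A , above (2 * f) f<2f , λ s _ s≢0 → above (f + s) (m<m+n f (n≢0⇒n>0 s≢0))
  where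
  f<2f : f < 2 * f
  f<2f = subst (f <_) (sym (2*m≡m+m f)) (m<m+n f (n≢0⇒n>0 (∉⇒≢0 A 0∈A f∉A)))

IsNumSG-∪[] : ∀ A → IsNumSG A → IsSG A h → IsNumSG (A ∪[ h ])
IsNumSG-∪[] {h} A (0∈A , +-closed , c , cofinite) (_ , 2h∈A , h+A⊆A) =
  ∈-∪[]⁺ {h = h} A 0∈A , closed , c , λ x c≤x → ∈-∪[]⁺ A (cofinite x c≤x)
  where
  h+A⊆A∪h : ∀ s → s ∈ A → (h + s) ∈ (A ∪[ h ])
  h+A⊆A∪h s s∈A with s ≟ 0
  ... | yes refl = subst (_∈ (A ∪[ h ])) (sym (+-identityʳ h)) (∈-∪[]-self A)
  ... | no s≢0   = ∈-∪[]⁺ A (h+A⊆A s s∈A s≢0)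
  closed : ∀ x y → x ∈ (A ∪[ h ]) → y ∈ (A ∪[ h ]) → (x + y) ∈ (A ∪[ h ])
  closed x y x∈ y∈ with ∈-∪[]⁻ A x∈ | ∈-∪[]⁻ A y∈
  ... | inj₁ x∈A | inj₁ y∈A = ∈-∪[]⁺ A (+-closed x y x∈A y∈A)
  ... | inj₁ x∈A | inj₂ refl = subst (_∈ (A ∪[ h ])) (+-comm h x) (h+A⊆A∪h x x∈A)
  ... | inj₂ refl | inj₁ y∈A = h+A⊆A∪h y y∈A
  ... | inj₂ refl | inj₂ refl = ∈-∪[]⁺ A (subst (_∈ A) (2*m≡m+m h) 2h∈A)

IsNumSG-∖[] : ∀ A → IsNumSG A → IsMinGen A y → IsNumSG (A ∖[ y ])
IsNumSG-∖[] {y} A (0∈A , +-closed , c , cofinite) (_ , y≢0 , indecomposable) =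
  ∈-∖[]⁺ A 0∈A (≢-sym y≢0) , closed , suc (y + c) ,
  λ x y+c<x → ∈-∖[]⁺ A (cofinite x (≤-trans (m≤n+m c y) (<⇒≤ y+c<x)))
                       (≢-sym (<⇒≢ (≤-<-trans (m≤m+n y c) y+c<x)))
  where
  closed : ∀ a b → a ∈ (A ∖[ y ]) → b ∈ (A ∖[ y ]) → (a + b) ∈ (A ∖[ y ])
  closed a b a∈ b∈ with ∈-∖[]⁻ A a∈ | ∈-∖[]⁻ A b∈
  ... | a∈A , a≢y | b∈A , b≢y = ∈-∖[]⁺ A (+-closed a b a∈A b∈A) a+b≢y
    where
    a+b≢y : a + b ≢ y
    a+b≢y a+b≡y with a ≟ 0 | b ≟ 0
    ... | yes refl | _        = b≢y a+b≡y
    ... | no _     | yes refl = a≢y (trans (sym (+-identityʳ a)) a+b≡y)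
    ... | no a≢0   | no b≢0   = indecomposable (a , b , a∈A , b∈A , a≢0 , b≢0 , a+b≡y)

IsSG-∖[] : ∀ A → IsNumSG A → y ∈ A → y ≢ 0 → IsSG (A ∖[ y ]) y
IsSG-∖[] {y} A ns@(_ , +-closed , _) y∈A y≢0 =
  ∉-∖[]-self A ,
  ∈-∖[]⁺ A (2*-∈ A ns y∈A) (subst (_≢ y) (sym (2*m≡m+m y)) (m+n≢m y y≢0)) ,
  λ s s∈ s≢0 → ∈-∖[]⁺ A (+-closed y s y∈A (proj₁ (∈-∖[]⁻ A s∈))) (m+n≢m y s≢0)

IsSG-∪[]⁻ : ∀ A → h < k → IsSG (A ∪[ h ]) k → IsSG A k
IsSG-∪[]⁻ {h} {k} A h<k (k∉ , 2k∈ , k+⊆) =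
  ∉-∪[]⁻ A k∉ ,
  from-above (2 * k) (subst (k ≤_) (sym (2*m≡m+m k)) (m≤m+n k k)) 2k∈ ,
  λ s s∈A s≢0 → from-above (k + s) (m≤m+n k s) (k+⊆ s (∈-∪[]⁺ A s∈A) s≢0)
  where
  from-above : ∀ x → k ≤ x → x ∈ (A ∪[ h ]) → x ∈ A
  from-above x k≤x x∈ with ∈-∪[]⁻ A x∈
  ... | inj₁ x∈A  = x∈A
  ... | inj₂ refl = contradiction k≤x (<⇒≱ h<k)

IsSG-∖[]⁻ : ∀ A → IsFrob A f → f ≤ 2 * y → y < k → IsSG (A ∖[ y ]) k → IsSG A k
IsSG-∖[]⁻ {f} {y} {k} A (_ , above) f≤2y y<k (k∉ , 2k∈ , k+⊆) =
  ∉-∖[]⁻ A k∉ (≢-sym (<⇒≢ y<k)) , proj₁ (∈-∖[]⁻ A 2k∈) , k+⊆A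
  where
  k+⊆A : ∀ s → s ∈ A → s ≢ 0 → (k + s) ∈ A
  k+⊆A s s∈A s≢0 with s ≟ y
  ... | yes refl =
    above (k + s) (≤-<-trans f≤2y (subst (_< k + s) (sym (2*m≡m+m s)) (+-monoˡ-< s y<k)))
  ... | no s≢y   = proj₁ (∈-∖[]⁻ A (k+⊆ s (∈-∖[]⁺ A s∈A s≢y) s≢0))

IsMinGen-∪[]-self : ∀ A → IsNumSG A → h ∉ A → IsMinGen (A ∪[ h ]) h
IsMinGen-∪[]-self {h} A (0∈A , +-closed , _) h∉A =
  ∈-∪[]-self A , ∉⇒≢0 A 0∈A h∉A ,
  λ (a , b , a∈ , b∈ , a≢0 , b≢0 , a+b≡h) →
    ∈-∉-≢ A (+-closed a b (summand∈A a∈ b≢0 a+b≡h) (summand∈A b∈ a≢0 (trans (+-comm b a) a+b≡h)))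
          h∉A a+b≡h
  where
  summand∈A : ∀ {a b} → a ∈ (A ∪[ h ]) → b ≢ 0 → a + b ≡ h → a ∈ A
  summand∈A {a} a∈ b≢0 a+b≡h with ∈-∪[]⁻ A a∈
  ... | inj₁ a∈A  = a∈A
  ... | inj₂ refl = contradiction a+b≡h (m+n≢m a b≢0)

PF-or-witness : ∀ A → IsFrob A f → ∀ x →
  (∀ s → s ∈ A → s ≢ 0 → (x + s) ∈ A) ⊎ ∃[ s ] (s ∈ A × s ≢ 0 × (x + s) ∉ A)
PF-or-witness {f} A Frob x
  with anyUpTo? (λ s → s ∈? A ×-dec ¬? (s ≟ 0) ×-dec ¬? ((x + s) ∈? A)) (suc f)
... | yes (s , _ , s∈A , s≢0 , x+s∉A) = inj₂ (s , s∈A , s≢0 , ¬∈⇒∉ A x+s∉A)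
... | no none = inj₁ x+A⊆A
  where
  x+A⊆A : ∀ s → s ∈ A → s ≢ 0 → (x + s) ∈ A
  x+A⊆A s s∈A s≢0 with (x + s) ∈? A
  ... | yes x+s∈A = x+s∈A
  ... | no x+s∉A  = contradiction (s , s<1+f , s∈A , s≢0 , x+s∉A) none
    where
    s<1+f : s < suc f
    s<1+f = s≤s (≤-trans (m≤n+m s x) (gap≤Frob A Frob (¬∈⇒∉ A x+s∉A)))

IsSG? : ∀ A → IsFrob A f → ∀ k → Dec (IsSG A k)
IsSG? A Frob k with k ∈? A | (2 * k) ∈? A | PF-or-witness A Frob k
... | yes k∈A | _        | _ = no λ (k∉A , _) → ∈-∉-≢ A k∈A k∉A refl
... | no _    | no 2k∉A  | _ = no λ (_ , 2k∈A , _) → 2k∉A 2k∈A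
... | no _    | yes _    | inj₂ (s , s∈A , s≢0 , k+s∉A) =
  no λ (_ , _ , k+A⊆A) → ∈-∉-≢ A (k+A⊆A s s∈A s≢0) k+s∉A refl
... | no k∉A  | yes 2k∈A | inj₁ k+A⊆A = yes (¬∈⇒∉ A k∉A , 2k∈A , k+A⊆A)

greatest-below : {P : ℕ → Set} → Decidable P → ∀ N →
  (∀ k → k < N → ¬ P k) ⊎ ∃[ k ] (P k × ∀ k′ → k′ < N → P k′ → k′ ≤ k)
greatest-below P? zero = inj₁ λ _ ()
greatest-below P? (suc N) with P? N
... | yes PN = inj₂ (N , PN , λ _ k′<1+N _ → ≤-pred k′<1+N)
... | no ¬PN with greatest-below P? N
...   | inj₁ none =
  inj₁ λ k k<1+N → [ none k , (λ { refl → ¬PN }) ]′ (m<1+n⇒m<n∨m≡n k<1+N)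
...   | inj₂ (k , Pk , max) =
  inj₂ (k , Pk , λ k′ k′<1+N Pk′ →
    [ (λ k′<N → max k′ k′<N Pk′) , (λ { refl → contradiction Pk′ ¬PN }) ]′ (m<1+n⇒m<n∨m≡n k′<1+N))

maxSGExcept-or-none : ∀ A → IsFrob A f → ¬ HasSGExcept A f ⊎ ∃[ k ] IsMaxSGExcept A f k
maxSGExcept-or-none {f} A Frob
  with greatest-below (λ k → IsSG? A Frob k ×-dec ¬? (k ≟ f)) (suc f)
... | inj₁ none = inj₁ λ (k , sg , k≢f) → none k (s≤s (gap≤Frob A Frob (proj₁ sg))) (sg , k≢f)
... | inj₂ (k , (sg , k≢f) , max) =
  inj₂ (k , sg , k≢f , λ k′ sg′ k′≢f → max k′ (s≤s (gap≤Frob A Frob (proj₁ sg′))) (sg′ , k′≢f))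

-- From a gap x: either x + s is a gap for some s ∈ A ∖ {0}, or x is pseudo-Frobenius and then
-- x is special unless 2x is a gap. Each move increases x and gaps are ≤ f, so f + 1 moves suffice.
module _ (A : NSet) (0∈A : 0 ∈ A) (Frob : IsFrob A f) (Q : ℕ → Set)
         (Q-+ : ∀ z s → Q z → s ∈ A → s ≢ 0 → Q (z + s))
         (Q-2* : ∀ z → Q z → IsPF A z → (2 * z) ∉ A → Q (2 * z)) where

  private
    fuel-step : ∀ {x s fuel} → s ≢ 0 → x + suc fuel ≤ x + s + fuel
    fuel-step {x} {s} {fuel} s≢0 =
      ≤-trans (+-monoʳ-≤ x (+-monoˡ-≤ fuel (n≢0⇒n>0 s≢0))) (≤-reflexive (sym (+-assoc x s fuel)))

    climb : ∀ fuel x → f < x + fuel → Q x → x ∉ A → ∃[ z ] (Q z × IsSG A z)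
    climb zero x f<x _ x∉A =
      ⊥-elim (∈-∉-≢ A (proj₂ Frob x (subst (f <_) (+-identityʳ x) f<x)) x∉A refl)
    climb (suc fuel) x f<x+1+fuel Qx x∉A with PF-or-witness A Frob x
    ... | inj₂ (s , s∈A , s≢0 , x+s∉A) =
      climb fuel (x + s) (<-≤-trans f<x+1+fuel (fuel-step s≢0)) (Q-+ x s Qx s∈A s≢0) x+s∉A
    ... | inj₁ x+A⊆A with (2 * x) ∈? A
    ...   | yes 2x∈A = x , Qx , x∉A , 2x∈A , x+A⊆A
    ...   | no 2x∉A  =
      climb fuel (2 * x) (<-≤-trans f<x+1+fuel x+1+fuel≤2x+fuel)
            (Q-2* x Qx (x∉A , x+A⊆A) (¬∈⇒∉ A 2x∉A)) (¬∈⇒∉ A 2x∉A)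
      where
      x+1+fuel≤2x+fuel : x + suc fuel ≤ 2 * x + fuel
      x+1+fuel≤2x+fuel = subst (λ w → x + suc fuel ≤ w + fuel) (sym (2*m≡m+m x))
                           (fuel-step (∉⇒≢0 A 0∈A x∉A))

  special-gap-reachable : ∀ x → Q x → x ∉ A → ∃[ z ] (Q z × IsSG A z)
  special-gap-reachable x = climb (suc f) x (<-≤-trans (n<1+n f) (m≤n+m (suc f) x))

-- Irreducibility

⊂-∪[] : ∀ A → h ∉ A → A ⊂ (A ∪[ h ])
⊂-∪[] {h} A h∉A = (λ _ → ∈-∪[]⁺ A) , h , ∈-∪[]-self A , h∉A

∪[]-∧-∪[] : ∀ A → k ≢ f → ∀ x → A x ≡ ((A ∪[ k ]) x ∧ (A ∪[ f ]) x)
∪[]-∧-∪[] {k} {f} A k≢f x with x ≟ k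
... | yes refl = begin
  A x                          ≡⟨ sym (∧-abs-∨ (A x) _) ⟩
  A x ∧ (A ∪[ x ]) x           ≡⟨ ∧-comm (A x) _ ⟩
  (A ∪[ x ]) x ∧ A x           ≡⟨ cong ((A ∪[ x ]) x ∧_) (sym (∪[]-≢ A k≢f)) ⟩
  (A ∪[ x ]) x ∧ (A ∪[ f ]) x  ∎
  where open ≡-Reasoning
... | no x≢k rewrite ∪[]-≢ A x≢k = sym (∧-abs-∨ (A x) _)

irreducible⇒¬HasSGExcept : ∀ A → IsNumSG A → IsFrob A f → Irreducible A → ¬ HasSGExcept A f
irreducible⇒¬HasSGExcept {f} A ns Frob irreducible (k , sg , k≢f) =
  irreducible (A ∪[ k ] , A ∪[ f ] , IsNumSG-∪[] A ns sg , IsNumSG-∪[] A ns (Frob-IsSG A ns Frob) ,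
               ⊂-∪[] A (proj₁ sg) , ⊂-∪[] A (proj₁ Frob) , ∪[]-∧-∪[] A k≢f)

¬HasSGExcept⇒irreducible : ∀ A → 0 ∈ A → IsFrob A f → ¬ HasSGExcept A f → Irreducible A
¬HasSGExcept⇒irreducible {f} A 0∈A Frob none (S₁ , S₂ , ns₁ , ns₂ , A⊂S₁ , A⊂S₂ , A≡S₁∧S₂) =
  ∈-∉-≢ A (trans (A≡S₁∧S₂ f) (cong₂ _∧_ (Frob∈ S₁ ns₁ A⊂S₁) (Frob∈ S₂ ns₂ A⊂S₂))) (proj₁ Frob) refl
  where
  -- the special gap reached from a gap of A lying in S stays in S, and it can only be f
  Frob∈ : ∀ S → IsNumSG S → A ⊂ S → f ∈ S
  Frob∈ S (_ , +-closed , _) (A⊆S , x , x∈S , x∉A)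
    with special-gap-reachable A 0∈A Frob (_∈ S)
           (λ z s z∈S s∈A _ → +-closed z s z∈S (A⊆S s s∈A))
           (λ z z∈S _ _ → subst (_∈ S) (sym (2*m≡m+m z)) (+-closed z z z∈S z∈S))
           x x∈S x∉A
  ... | z , z∈S , sg with z ≟ f
  ...   | yes refl = z∈S
  ...   | no z≢f   = contradiction (z , sg , z≢f) none

-- The second largest special gap

special-gap-above : ∀ A → IsNumSG A → IsFrob A f → ∀ {r} → r ∉ A → f < 2 * r →
                    ∃[ d ] (d ∈ A × IsSG A (r + d))
special-gap-above {f} A (0∈A , +-closed , _) Frob {r} r∉A f<2r
  with special-gap-reachable A 0∈A Frob ShiftOfr shift-+ shift-2* r (0 , 0∈A , +-identityʳ r) r∉A
  where
  ShiftOfr : ℕ → Set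
  ShiftOfr z = ∃[ d ] (d ∈ A × r + d ≡ z)
  shift-+ : ∀ z s → ShiftOfr z → s ∈ A → s ≢ 0 → ShiftOfr (z + s)
  shift-+ z s (d , d∈A , r+d≡z) s∈A _ =
    d + s , +-closed d s d∈A s∈A , trans (sym (+-assoc r d s)) (cong (_+ s) r+d≡z)
  shift-2* : ∀ z → ShiftOfr z → IsPF A z → (2 * z) ∉ A → ShiftOfr (2 * z)
  shift-2* z (d , d∈A , r+d≡z) (_ , z+A⊆A) 2z∉A with d ≟ 0
  ... | yes refl = ⊥-elim (∈-∉-≢ A (proj₂ Frob (2 * z) f<2z) 2z∉A refl)
    where
    f<2z : f < 2 * z
    f<2z = subst (λ w → f < 2 * w) (trans (sym (+-identityʳ r)) r+d≡z) f<2r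
  ... | no d≢0 = z + d , z+A⊆A d d∈A d≢0 , (begin
    r + (z + d) ≡⟨ cong (r +_) (+-comm z d) ⟩
    r + (d + z) ≡⟨ sym (+-assoc r d z) ⟩
    r + d + z   ≡⟨ cong (_+ z) r+d≡z ⟩
    z + z       ≡⟨ sym (2*m≡m+m z) ⟩
    2 * z       ∎)
    where open ≡-Reasoning
... | _ , (d , d∈A , refl) , sg = d , d∈A , sg

larger-special-gap : ∀ A → IsNumSG A → IsFrob A f → IsSG A k → 2 * k < f →
                     ∃[ z ] (IsSG A z × z ≢ f × k < z)
larger-special-gap {f} {k} A ns@(0∈A , _) Frob (k∉A , _ , k+A⊆A) 2k<f
  with m≤n⇒∃[o]m+o≡n (<⇒≤ (≤-<-trans (m≤n*m k 2) 2k<f))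
... | r , k+r≡f = larger (special-gap-above A ns Frob r∉A f<2r)
  where
  k<r : k < r
  k<r = +-cancelˡ-< k k r (subst₂ _<_ (2*m≡m+m k) (sym k+r≡f) 2k<f)
  f<2r : f < 2 * r
  f<2r = subst₂ _<_ (trans (+-comm r k) k+r≡f) (sym (2*m≡m+m r)) (+-monoʳ-< r k<r)
  r∉A : r ∉ A
  r∉A = ¬∈⇒∉ A λ r∈A → ∈-∉-≢ A (k+A⊆A r r∈A (≢-sym (<⇒≢ (≤-<-trans z≤n k<r)))) (proj₁ Frob) k+r≡f
  larger : ∃[ d ] (d ∈ A × IsSG A (r + d)) → ∃[ z ] (IsSG A z × z ≢ f × k < z)
  larger (d , d∈A , sg) = r + d , sg , r+d≢f , <-≤-trans k<r (m≤m+n r d)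
    where
    r+d≢f : r + d ≢ f
    r+d≢f r+d≡f = ∈-∉-≢ A d∈A k∉A (+-cancelˡ-≡ r d k (trans r+d≡f (trans (sym k+r≡f) (+-comm k r))))

Frob<2*maxSGExcept : ∀ A → IsNumSG A → IsFrob A f → IsMaxSGExcept A f k → f < 2 * k
Frob<2*maxSGExcept {f} {k} A ns Frob (sg@(_ , 2k∈A , _) , _ , k-max) with f <? 2 * k
... | yes f<2k = f<2k
... | no f≮2k with larger-special-gap A ns Frob sg (≤∧≢⇒< (≮⇒≥ f≮2k) (∈-∉-≢ A 2k∈A (proj₁ Frob)))
...   | z , sg-z , z≢f , k<z = contradiction (k-max z sg-z z≢f) (<⇒≱ k<z)

-- The semigroup S_{g,n}

SgnSpec : ℕ → ℕ → ℕ → Set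
SgnSpec g n x = x ≡ 0 ⊎ (g ≤ x × x < g + n ∸ 1) ⊎ g + n ≤ x

Sgn-∈⁻ : ∀ g n x → x ∈ Sgn g n → SgnSpec g n x
Sgn-∈⁻ g n x x∈ =
  Sum.map (≡ᵇ⇒≡ x 0) (Sum.map middle (≤ᵇ⇒≤ (g + n) x))
    (Sum.map₂ (Equivalence.to T-∨) (Equivalence.to T-∨ (Equivalence.from T-≡ x∈)))
  where
  middle : T ((g ≤ᵇ x) ∧ (x <ᵇ g + n ∸ 1)) → g ≤ x × x < g + n ∸ 1
  middle t = let g≤x , x<F = Equivalence.to T-∧ t in ≤ᵇ⇒≤ g x g≤x , <ᵇ⇒< x _ x<F

Sgn-∈⁺ : ∀ g n x → SgnSpec g n x → x ∈ Sgn g n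
Sgn-∈⁺ g n x spec =
  Equivalence.to T-≡ (Equivalence.from T-∨
    (Sum.map (≡⇒≡ᵇ x 0) (λ t → Equivalence.from T-∨ (Sum.map middle ≤⇒≤ᵇ t)) spec))
  where
  middle : g ≤ x × x < g + n ∸ 1 → T ((g ≤ᵇ x) ∧ (x <ᵇ g + n ∸ 1))
  middle (g≤x , x<F) = Equivalence.from T-∧ (≤⇒≤ᵇ g≤x , <⇒<ᵇ x<F)

module _ (g n : ℕ) where

  private
    S : NSet
    S = Sgn (suc g) (suc n)

    gap-run : ∀ x → 1 ≤ x → x < suc g → x ∉ S
    gap-run x 1≤x x<1+g = ¬∈⇒∉ {x} S λ x∈S → case Sgn-∈⁻ (suc g) (suc n) x x∈S of λ where
      (inj₁ refl)              → contradiction 1≤x λ ()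
      (inj₂ (inj₁ (1+g≤x , _))) → <⇒≱ x<1+g 1+g≤x
      (inj₂ (inj₂ G≤x))        → <⇒≱ x<1+g (≤-trans (m≤m+n (suc g) (suc n)) G≤x)

    member-run : ∀ x → suc g ≤ x → x < suc g + n → x ∈ S
    member-run x 1+g≤x x<1+g+n =
      Sgn-∈⁺ (suc g) (suc n) x (inj₂ (inj₁ (1+g≤x , subst (x <_) (sym (+-suc g n)) x<1+g+n)))

  Sgn-IsFrob : IsFrob (Sgn (suc g) (suc n)) (g + suc n)
  Sgn-IsFrob = ¬∈⇒∉ {g + suc n} S F∉ , λ x F<x → Sgn-∈⁺ (suc g) (suc n) x (inj₂ (inj₂ F<x))
    where
    F∉ : ¬ (g + suc n) ∈ S
    F∉ F∈ with Sgn-∈⁻ (suc g) (suc n) (g + suc n) F∈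
    ... | inj₁ F≡0               = 1+n≢0 (m+n≡0⇒n≡0 g F≡0)
    ... | inj₂ (inj₁ (_ , F<F)) = <-irrefl refl F<F
    ... | inj₂ (inj₂ F<F)        = <-irrefl refl F<F

  countMem-Sgn : countMem (Sgn (suc g) (suc n)) (g + suc n) ≡ suc n
  countMem-Sgn = begin
    countMem S (g + suc n)  ≡⟨ cong (countMem S) (+-suc g n) ⟩
    countMem S (suc g + n)  ≡⟨ countMem-run-∈ S (suc g) n member-run ⟩
    countMem S (1 + g) + n  ≡⟨ cong (_+ n) (countMem-run-∉ S 1 g gap-run) ⟩
    suc n                   ∎
    where open ≡-Reasoning

  Sgn-genus : HasGenus (Sgn (suc g) (suc n)) (suc g)
  Sgn-genus = suc g + suc n , (λ x G≤x → Sgn-∈⁺ (suc g) (suc n) x (inj₂ (inj₂ G≤x))) ,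
    +-cancelˡ-≡ (suc n) _ _ (begin
      suc n + countGaps S G+N          ≡⟨ cong (_+ countGaps S G+N) members ⟩
      countMem S G+N + countGaps S G+N ≡⟨ countMem+countGaps S G+N ⟩
      suc g + suc n                    ≡⟨ +-comm (suc g) (suc n) ⟩
      suc n + suc g                    ∎)
    where
    open ≡-Reasoning
    G+N : ℕ
    G+N = suc g + suc n
    members : suc n ≡ countMem S G+N
    members = sym (trans (countMem-suc-∉ {c = g + suc n} S (proj₁ Sgn-IsFrob)) countMem-Sgn)

InH⇒genus×n : ∀ {g n T} → 0 < g → 0 < n → InH g n T → IsFrob T f →
              HasGenus T g × countMem T f ≡ n
InH⇒genus×n {n = n} {T} _ _ (_ , inj₂ (_ , genus , _ , Frob′ , count)) Frob =
  genus , subst (λ w → countMem T w ≡ n) (Frob-unique T Frob′ Frob) count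
InH⇒genus×n {f} {suc g} {suc n} {T} (s≤s z≤n) (s≤s z≤n) (_ , inj₁ T≐Sgn) Frob =
  HasGenus-resp-≐ (≐-sym T≐Sgn) (Sgn-genus g n) , (begin
    countMem T f                           ≡⟨ cong (countMem T) f≡F ⟩
    countMem T (g + suc n)                 ≡⟨ countMem-cong (g + suc n) (λ x _ → T≐Sgn x) ⟩
    countMem (Sgn (suc g) (suc n)) (g + suc n) ≡⟨ countMem-Sgn g n ⟩
    suc n                                  ∎)
  where
  open ≡-Reasoning
  f≡F : f ≡ g + suc n
  f≡F = Frob-unique T Frob (IsFrob-resp-≐ (≐-sym T≐Sgn) (Sgn-IsFrob g n))

GeneratorBound : NSet → ℕ → ℕ → ℕ → Set
GeneratorBound T f h y =
  (Irreducible (T ∪[ h ]) → 2 * y < f) ×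
  (¬ Irreducible (T ∪[ h ]) → ∀ k → IsMaxSGExcept (T ∪[ h ]) f k → y < k)

LeafCriterion : NSet → ℕ → ℕ → Set
LeafCriterion T f m = ∀ h → IsSG T h →
  (m < h) ⊎ (∀ y → IsMinGen (T ∪[ h ]) y → y ≢ h → y < f → GeneratorBound T f h y)

-- Children: A((T ∪ {h}) ∖ {y}) = T

module Child {T : NSet} {f m h y : ℕ}
  (ns : IsNumSG T) (Frob : IsFrob T f) (Mult : IsMult T m)
  (sg : IsSG T h) (h<m : h < m) (h≢f : h ≢ f)
  (mingen : IsMinGen (T ∪[ h ]) y) (y≢h : y ≢ h) (y<f : y < f) where

  private
    T∪h : NSet
    T∪h = T ∪[ h ]

    T∪h-IsNumSG : IsNumSG T∪h
    T∪h-IsNumSG = IsNumSG-∪[] T ns sg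

    T∪h-IsFrob : IsFrob T∪h f
    T∪h-IsFrob = IsFrob-∪[] T Frob h≢f

    y∈T∪h : y ∈ T∪h
    y∈T∪h = proj₁ mingen

    h<y : h < y
    h<y with ∈-∪[]⁻ T y∈T∪h
    ... | inj₁ y∈T  = <-≤-trans h<m (proj₂ (proj₂ Mult) y y∈T (proj₁ (proj₂ mingen)))
    ... | inj₂ y≡h  = contradiction y≡h y≢h

  S : NSet
  S = T∪h ∖[ y ]

  S-IsNumSG : IsNumSG S
  S-IsNumSG = IsNumSG-∖[] T∪h T∪h-IsNumSG mingen

  S-IsFrob : IsFrob S f
  S-IsFrob = IsFrob-∖[] T∪h T∪h-IsFrob y<f

  S-IsMult : IsMult S h
  S-IsMult = ∈-∖[]⁺ T∪h (∈-∪[]-self T) (≢-sym y≢h) , ∉⇒≢0 T (proj₁ ns) (proj₁ sg) , h-min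
    where
    h-min : ∀ x → x ∈ S → x ≢ 0 → h ≤ x
    h-min x x∈S x≢0 with ∈-∪[]⁻ T (proj₁ (∈-∖[]⁻ T∪h x∈S))
    ... | inj₁ x∈T  = <⇒≤ (<-≤-trans h<m (proj₂ (proj₂ Mult) x x∈T x≢0))
    ... | inj₂ refl = ≤-refl

  y-IsSG : IsSG S y
  y-IsSG = IsSG-∖[] T∪h T∪h-IsNumSG y∈T∪h (proj₁ (proj₂ mingen))

  S-nonspecial : ¬ Special S
  S-nonspecial special = <⇒≱ h<y (special f h S-IsFrob S-IsMult y y-IsSG (<⇒≢ y<f))

  y-IsMaxSGExcept : f ≤ 2 * y → (∀ k → IsSG (T ∪[ h ]) k → k ≢ f → k < y) → IsMaxSGExcept S f y
  y-IsMaxSGExcept f≤2y below-y = y-IsSG , <⇒≢ y<f , λ k sg-k k≢f →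
    ≮⇒≥ λ y<k → <-asym y<k (below-y k (IsSG-∖[]⁻ T∪h T∪h-IsFrob f≤2y y<k sg-k) k≢f)

  A[S]≐T : T ≐ (S ∪[ y ]) ∖[ h ]
  A[S]≐T = ≐-sym (≐-trans (∖[]-resp-≐ (∖[]-∪[]-cancel T∪h y∈T∪h)) (∪[]-∖[]-cancel T (proj₁ sg)))

  countMem-S : ∀ c → y < c → countMem S c ≡ countMem T c
  countMem-S c y<c = suc-injective (begin
    suc (countMem S c) ≡⟨ countMem-∖[] T∪h y∈T∪h y<c ⟨
    countMem T∪h c     ≡⟨ countMem-∪[] T (proj₁ sg) (<-trans h<y y<c) ⟩
    suc (countMem T c) ∎)
    where open ≡-Reasoning

  S-InH : ∀ {g n} → HasGenus T g → countMem T f ≡ n → InH g n S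
  S-InH {g} (c , above , gaps) count =
    S-IsNumSG , inj₂ (S-nonspecial , S-genus , f , S-IsFrob , trans (countMem-S f y<f) count)
    where
    f<c : f < c
    f<c = ≰⇒> λ c≤f → ∈-∉-≢ T (above f c≤f) (proj₁ Frob) refl
    S-genus : HasGenus S g
    S-genus = c , (λ x c≤x → proj₂ S-IsFrob x (<-≤-trans f<c c≤x)) ,
              trans (countGaps-cong-countMem S T c (countMem-S c (<-trans y<f f<c))) gaps

  T-has-child : ∀ {g n} → HasGenus T g → countMem T f ≡ n →
                f ≤ 2 * y → (∀ k → IsSG (T ∪[ h ]) k → k ≢ f → k < y) → ¬ IsLeaf g n T
  T-has-child genus count f≤2y below-y leaf =
    leaf (S , S-InH genus count , S-nonspecial ,
          f , y , h , S-IsFrob , y-IsMaxSGExcept f≤2y below-y , S-IsMult , A[S]≐T)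

-- Parents: properties of T = A(S)

module Parent {S T : NSet} {f h m : ℕ}
  (ns : IsNumSG S) (Frob : IsFrob S f) (maxSG : IsMaxSGExcept S f h) (Mult : IsMult S m)
  (nonspecial : ¬ Special S) (T≐ : T ≐ (S ∪[ h ]) ∖[ m ]) where

  m<h : m < h
  m<h with m <? h
  ... | yes m<h = m<h
  ... | no m≮h  = contradiction special nonspecial
    where
    special : Special S
    special f′ m′ Frob′ Mult′ h′ sg′ h′≢f′ =
      subst (h′ ≤_) (Mult-unique S Mult Mult′)
        (≤-trans (proj₂ (proj₂ maxSG) h′ sg′ (h′≢f′ ∘ λ h′≡f → trans h′≡f (Frob-unique S Frob Frob′)))
                 (≮⇒≥ m≮h))

  h<f : h < f
  h<f = ≤∧≢⇒< (gap≤Frob S Frob (proj₁ (proj₁ maxSG))) (proj₁ (proj₂ maxSG))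

  private
    h-IsSG : IsSG S h
    h-IsSG = proj₁ maxSG

    S∪h-IsNumSG : IsNumSG (S ∪[ h ])
    S∪h-IsNumSG = IsNumSG-∪[] S ns h-IsSG

    S∪h-IsFrob : IsFrob (S ∪[ h ]) f
    S∪h-IsFrob = IsFrob-∪[] S Frob (proj₁ (proj₂ maxSG))

    m∈S∪h : m ∈ (S ∪[ h ])
    m∈S∪h = ∈-∪[]⁺ S (proj₁ Mult)

    T∪m≐S∪h : T ∪[ m ] ≐ S ∪[ h ]
    T∪m≐S∪h = ≐-trans (∪[]-resp-≐ T≐) (∖[]-∪[]-cancel (S ∪[ h ]) m∈S∪h)

    T∪m-IsFrob : IsFrob (T ∪[ m ]) f
    T∪m-IsFrob = IsFrob-resp-≐ (≐-sym T∪m≐S∪h) S∪h-IsFrob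

  T-IsFrob : IsFrob T f
  T-IsFrob = IsFrob-resp-≐ (≐-sym T≐) (IsFrob-∖[] (S ∪[ h ]) S∪h-IsFrob (<-trans m<h h<f))

  m-IsSG : IsSG T m
  m-IsSG = IsSG-resp-≐ (≐-sym T≐) (IsSG-∖[] (S ∪[ h ]) S∪h-IsNumSG m∈S∪h (proj₁ (proj₂ Mult)))

  m<Mult : ∀ {mT} → IsMult T mT → m < mT
  m<Mult {mT} (mT∈T , mT≢0 , _) with ∈-∖[]⁻ (S ∪[ h ]) (∈-resp-≐ T≐ mT∈T)
  ... | mT∈S∪h , mT≢m with ∈-∪[]⁻ S mT∈S∪h
  ...   | inj₁ mT∈S  = ≤∧≢⇒< (proj₂ (proj₂ Mult) mT mT∈S mT≢0) (≢-sym mT≢m)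
  ...   | inj₂ refl  = m<h

  h-IsMinGen : IsMinGen (T ∪[ m ]) h
  h-IsMinGen = IsMinGen-resp-≐ (≐-sym T∪m≐S∪h) (IsMinGen-∪[]-self S ns (proj₁ h-IsSG))

  Frob<2h : f < 2 * h
  Frob<2h = Frob<2*maxSGExcept S ns Frob maxSG

  -- a special gap of T ∪ {m} = S ∪ {h} above h would be a special gap of S above h
  T∪m-SG≤h : ∀ k → IsSG (T ∪[ m ]) k → k ≢ f → k ≤ h
  T∪m-SG≤h k sg-k k≢f = ≮⇒≥ λ h<k →
    <⇒≱ h<k (proj₂ (proj₂ maxSG) k (IsSG-∪[]⁻ S h<k (IsSG-resp-≐ T∪m≐S∪h sg-k)) k≢f)

  T∪m-reducible-with-max : ¬ Irreducible (T ∪[ m ]) → ∃[ k ] IsMaxSGExcept (T ∪[ m ]) f k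
  T∪m-reducible-with-max reducible with maxSGExcept-or-none (T ∪[ m ]) T∪m-IsFrob
  ... | inj₁ none =
    contradiction (¬HasSGExcept⇒irreducible (T ∪[ m ]) 0∈T∪m T∪m-IsFrob none) reducible
    where
    0∈T∪m : 0 ∈ (T ∪[ m ])
    0∈T∪m = ∈-resp-≐ (≐-sym T∪m≐S∪h) (proj₁ S∪h-IsNumSG)
  ... | inj₂ max = max

  criterion-fails : ∀ {fT mT} → IsFrob T fT → IsMult T mT → ¬ LeafCriterion T fT mT
  criterion-fails FrobT MultT criterion with Frob-unique T T-IsFrob FrobT
  ... | refl with criterion m m-IsSG
  ...   | inj₁ mT<m = <-asym mT<m (m<Mult MultT)
  ...   | inj₂ bounds with bounds h h-IsMinGen (≢-sym (<⇒≢ m<h)) h<f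
  ...     | irreducible⇒ , reducible⇒ = refute (T∪m-reducible-with-max reducible)
    where
    reducible : ¬ Irreducible (T ∪[ m ])
    reducible irreducible = <-asym Frob<2h (irreducible⇒ irreducible)
    refute : ∃[ k ] IsMaxSGExcept (T ∪[ m ]) f k → ⊥
    refute (k , max-k@(sg-k , k≢f , _)) = <⇒≱ (reducible⇒ reducible k max-k) (T∪m-SG≤h k sg-k k≢f)

criterion⇒leaf : ∀ {g n T} → IsFrob T f → IsMult T m → LeafCriterion T f m → IsLeaf g n T
criterion⇒leaf FrobT MultT criterion
  (_ , (ns , _) , nonspecial , _ , _ , _ , Frob , maxSG , Mult , T≐) =
  Parent.criterion-fails ns Frob maxSG Mult nonspecial T≐ FrobT MultT criterion

leaf⇒criterion : ∀ {g n T} → 2 ≤ n → IsNumSG T → HasGenus T g → IsFrob T f → IsMult T m →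
                 countMem T f ≡ n → IsLeaf g n T → LeafCriterion T f m
leaf⇒criterion {f} {m} {T = T} 2≤n ns genus Frob Mult count leaf h sg with m <? h
... | yes m<h = inj₁ m<h
... | no m≮h  = inj₂ bound
  where
  h<m : h < m
  h<m = ≤∧≢⇒< (≮⇒≥ m≮h) (≢-sym (∈-∉-≢ T (proj₁ Mult) (proj₁ sg)))
  -- below the multiplicity only 0 lies in T, while n(T) ≥ 2
  h≢f : h ≢ f
  h≢f refl = <⇒≱ (≤-trans 2≤n (≤-reflexive (sym count))) (countMem-belowMult T Mult (<⇒≤ h<m))
  T∪h-IsNumSG : IsNumSG (T ∪[ h ])
  T∪h-IsNumSG = IsNumSG-∪[] T ns sg
  T∪h-IsFrob : IsFrob (T ∪[ h ]) f
  T∪h-IsFrob = IsFrob-∪[] T Frob h≢f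
  bound : ∀ y → IsMinGen (T ∪[ h ]) y → y ≢ h → y < f → GeneratorBound T f h y
  bound y mingen y≢h y<f = irreducible-case , reducible-case
    where
    no-child : f ≤ 2 * y → (∀ k → IsSG (T ∪[ h ]) k → k ≢ f → k < y) → ⊥
    no-child f≤2y below-y =
      Child.T-has-child ns Frob Mult sg h<m h≢f mingen y≢h y<f genus count f≤2y below-y leaf
    irreducible-case : Irreducible (T ∪[ h ]) → 2 * y < f
    irreducible-case irreducible = ≰⇒> λ f≤2y → no-child f≤2y λ k sg-k k≢f →
      contradiction (k , sg-k , k≢f)
        (irreducible⇒¬HasSGExcept (T ∪[ h ]) T∪h-IsNumSG T∪h-IsFrob irreducible)
    reducible-case : ¬ Irreducible (T ∪[ h ]) → ∀ k → IsMaxSGExcept (T ∪[ h ]) f k → y < k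
    reducible-case _ k max-k@((k∉T∪h , _) , _ , k-max) = ≰⇒> λ k≤y →
      let k<y = ≤∧≢⇒< k≤y (≢-sym (∈-∉-≢ (T ∪[ h ]) (proj₁ mingen) k∉T∪h)) in
      no-child (<⇒≤ (<-≤-trans (Frob<2*maxSGExcept (T ∪[ h ]) T∪h-IsNumSG T∪h-IsFrob max-k)
                              (*-monoʳ-≤ 2 k≤y)))
               (λ k′ sg′ k′≢f → ≤-<-trans (k-max k′ sg′ k′≢f) k<y)

corollary5p7 : (g n : ℕ) → 3 < g → 2 ≤ n → n ≤ g ∸ 2 →
    (T : NSet) → InH g n T →
    (f m : ℕ) → IsFrob T f → IsMult T m →
    IsLeaf g n T ⇔
      (∀ h → IsSG T h →
        (m < h) ⊎
        (∀ y → IsMinGen (T ∪[ h ]) y → y ≢ h → y < f →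
          (Irreducible (T ∪[ h ]) → 2 * y < f) ×
          (¬ Irreducible (T ∪[ h ]) →
            ∀ k → IsMaxSGExcept (T ∪[ h ]) f k → y < k)))
corollary5p7 g n 3<g 2≤n _ T inH f m Frob Mult
  with InH⇒genus×n (<-trans (s≤s z≤n) 3<g) (≤-trans (s≤s z≤n) 2≤n) inH Frob
... | genus , count =
  mk⇔ (leaf⇒criterion 2≤n (proj₁ inH) genus Frob Mult count) (criterion⇒leaf Frob Mult)
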